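{- Let $\mathcal V=(d,Q,\Delta)$ be a VASS, $s,t\in Q$ and $\mathbf v\in\mathbb N^d$. Then $t(\mathbf 0)$ is reachable from $s(\mathbf v)$ in $\mathcal V$ under monus semantics if and only if there is $\mathbf v'\in\mathbb N^d$ with $\mathbf v'\ge\mathbf v$ such that $s(\mathbf v')$ is reachable from $t(\mathbf 0)$ in the reversed VASS $\mathcal V^{\mathrm{rev}}$ under classical semantics.
   Context: A VASS is a triple $\mathcal V=(d,Q,\Delta)$ with $Q$ finite and $\Delta\subseteq Q\times\mathbb Z^d\times Q$ finite; configurations are $p(\mathbf u)$ with $p\in Q$, $\mathbf u\in\mathbb N^d$. Classical semantics: a transition $(p,\mathbf z,q)$ takes $p(\mathbf u)$ to $q(\mathbf u+\mathbf z)$, allowed only if $\mathbf u+\mathbf z\ge\mathbf 0$. Monus semantics: $(p,\mathbf z,q)$ takes $p(\mathbf u)$ to $q(\max(\mathbf u+\mathbf z,\mathbf 0))$ (componentwise), always allowed. Reachability means existence of a finite sequence of such steps. The reversed VASS $\mathcal V^{\mathrm{rev}}=(d,Q,\Delta^{\mathrm{rev}})$ has a transition $(p,\mathbf z,q)$ iff $(q,-\mathbf z,p)\in\Delta$. Order $\ge$ on vectors is componentwise. -}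

module Defs where

open import Data.Nat using (ℕ)
open import Data.Integer as ℤ using (ℤ; +_; _+_; -_; _≤_)
open import Data.Fin using (Fin)
open import Data.Vec using (Vec; zipWith; map; replicate)
open import Data.Vec.Relation.Binary.Pointwise.Inductive using (Pointwise)
open import Data.List using (List)
open import Data.List.Membership.Propositional using (_∈_)
open import Data.Product using (_×_; _,_; Σ; ∃)
open import Relation.Binary.PropositionalEquality using (_≡_)
open import Relation.Binary.Construct.Closure.ReflexiveTransitive using (Star)

record VASS (d : ℕ) : Set where
  field
    states : ℕ
    trans  : List (Fin states × Vec ℤ d × Fin states)
open VASS public

Config : ∀ {d} → VASS d → Set
Config {d} V = Fin (states V) × Vec ℕ d

addZ : ∀ {d} → Vec ℕ d → Vec ℤ d → Vec ℤ d
addZ u z = zipWith (λ a b → (+ a) + b) u z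

data ClassicalStep {d} (V : VASS d) : Config V → Config V → Set where
  step : ∀ {p q z u w} → (p , z , q) ∈ trans V →
         addZ u z ≡ map +_ w →
         ClassicalStep V (p , u) (q , w)

data MonusStep {d} (V : VASS d) : Config V → Config V → Set where
  step : ∀ {p q z u} → (p , z , q) ∈ trans V →
         MonusStep V (p , u) (q , map (λ x → ℤ.∣ x ℤ.⊔ + 0 ∣) (addZ u z))

ClassicalReach : ∀ {d} (V : VASS d) → Config V → Config V → Set
ClassicalReach V = Star (ClassicalStep V)

MonusReach : ∀ {d} (V : VASS d) → Config V → Config V → Set
MonusReach V = Star (MonusStep V)

reverseT : ∀ {d n} → Fin n × Vec ℤ d × Fin n → Fin n × Vec ℤ d × Fin n
reverseT (p , z , q) = (q , map -_ z , p)

rev : ∀ {d} → VASS d → VASS d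
rev V = record { states = states V ; trans = Data.List.map reverseT (trans V) }

_≥ᵥ_ : ∀ {d} → Vec ℕ d → Vec ℕ d → Set
u ≥ᵥ v = Pointwise Data.Nat._≥_ u v

{-# OPTIONS --safe #-}
module Submission where

-- A monus step along z sends u to max(u + z, 0), and any w ≥ max(u + z, 0) has w − z ≥ u:
-- so the reversed transition fires classically from w and lands above u. Conversely, a
-- classical reversed step from w to w − z ≥ c matches the monus step from c, which lands
-- below w. Induction along paths propagates these dominations, and at t(0) domination
-- from above by 0 is equality.

open import Defs
open import Data.Nat as ℕ using (ℕ)
import Data.Nat.Properties as ℕ
open import Data.Fin using (Fin)
open import Data.Vec using (Vec; []; _∷_; map; replicate)
open import Data.Vec.Properties using (∷-injectiveˡ; ∷-injectiveʳ)
open import Data.Vec.Relation.Binary.Pointwise.Inductive as Pointwise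
  using ([]; _∷_)
open import Data.Integer as ℤ using (ℤ; +_; -_; _-_; _⊔_; ∣_∣; +≤+)
open import Data.Integer.Properties as ℤ
  using (0≤i⇒+∣i∣≡i; i≤i⊔j; i≤j⊔i; ⊔-lub; +-monoˡ-≤; drop‿+≤+; +-0-abelianGroup)
open import Algebra.Bundles using (AbelianGroup)
open import Algebra.Properties.Group (AbelianGroup.group +-0-abelianGroup)
  using (//-rightDividesˡ; //-rightDividesʳ)
open import Data.List.Membership.Propositional using (_∈_)
open import Data.List.Membership.Propositional.Properties using (∈-map⁺; ∈-map⁻)
open import Data.Product using (_×_; _,_; Σ; ∃-syntax)
open import Function.Bundles using (_⇔_; mk⇔; Equivalence)
open import Function.Construct.Composition using (_⇔-∘_)
open import Relation.Binary.PropositionalEquality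
  using (_≡_; refl; sym; subst; cong; cong₂)
open import Relation.Binary.Construct.Closure.ReflexiveTransitive using (ε; _◅_; _◅◅_)

monus : ℤ → ℕ
monus i = ∣ i ⊔ + 0 ∣

+monus[i]≡i⊔0 : ∀ i → + monus i ≡ i ⊔ + 0
+monus[i]≡i⊔0 i = 0≤i⇒+∣i∣≡i (ℤ.≤-trans (+≤+ ℕ.z≤n) (i≤j⊔i i (+ 0)))

monus≤⇔≤ : ∀ i n → monus i ℕ.≤ n ⇔ i ℤ.≤ + n
monus≤⇔≤ i n = mk⇔
  (λ monus≤n → ℤ.≤-trans (i≤i⊔j i (+ 0))
                 (subst (ℤ._≤ + n) (+monus[i]≡i⊔0 i) (+≤+ monus≤n)))
  (λ i≤n → drop‿+≤+ (subst (ℤ._≤ + n) (sym (+monus[i]≡i⊔0 i)) (⊔-lub i≤n (+≤+ ℕ.z≤n))))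

i+k≤j⇔i≤j-k : ∀ i j k → i ℤ.+ k ℤ.≤ j ⇔ i ℤ.≤ j - k
i+k≤j⇔i≤j-k i j k = mk⇔
  (λ i+k≤j → subst (ℤ._≤ j - k) (//-rightDividesʳ k i) (+-monoˡ-≤ (- k) i+k≤j))
  (λ i≤j-k → subst (i ℤ.+ k ℤ.≤_) (//-rightDividesˡ k j) (+-monoˡ-≤ k i≤j-k))

monus[u+z]≤a⇔u≤a-z : ∀ u a z → monus (+ u ℤ.+ z) ℕ.≤ a ⇔ + u ℤ.≤ + a - z
monus[u+z]≤a⇔u≤a-z u a z =
  i+k≤j⇔i≤j-k (+ u) (+ a) z ⇔-∘ monus≤⇔≤ (+ u ℤ.+ z) a

≥monus[u+z]⇒w-z≥u : ∀ {d} (u w : Vec ℕ d) (z : Vec ℤ d) → w ≥ᵥ map monus (addZ u z) →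
  ∃[ u′ ] u′ ≥ᵥ u × addZ w (map -_ z) ≡ map +_ u′
≥monus[u+z]⇒w-z≥u []       []       []       []          = [] , [] , refl
≥monus[u+z]⇒w-z≥u (u ∷ us) (w ∷ ws) (z ∷ zs) (le ∷ les)
  with ≥monus[u+z]⇒w-z≥u us ws zs les
... | us′ , us′≥us , eqs = ∣ w-z ∣ ∷ us′ , drop‿+≤+ u≤∣w-z∣ ∷ us′≥us , cong₂ _∷_ w-z≡+∣w-z∣ eqs
  where
  w-z : ℤ
  w-z = + w - z
  u≤w-z : + u ℤ.≤ w-z
  u≤w-z = Equivalence.to (monus[u+z]≤a⇔u≤a-z u w z) le
  w-z≡+∣w-z∣ : w-z ≡ + ∣ w-z ∣
  w-z≡+∣w-z∣ = sym (0≤i⇒+∣i∣≡i (ℤ.≤-trans (+≤+ ℕ.z≤n) u≤w-z))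
  u≤∣w-z∣ : + u ℤ.≤ + ∣ w-z ∣
  u≤∣w-z∣ = subst (+ u ℤ.≤_) w-z≡+∣w-z∣ u≤w-z

w-z≥c⇒≥monus[c+z] : ∀ {d} (c w w′ : Vec ℕ d) (z : Vec ℤ d) →
  addZ w (map -_ z) ≡ map +_ w′ → w′ ≥ᵥ c → w ≥ᵥ map monus (addZ c z)
w-z≥c⇒≥monus[c+z] []       []       []         []       _  []          = []
w-z≥c⇒≥monus[c+z] (c ∷ cs) (w ∷ ws) (w′ ∷ ws′) (z ∷ zs) eq (le ∷ les) =
  Equivalence.from (monus[u+z]≤a⇔u≤a-z c w z)
    (subst (+ c ℤ.≤_) (sym (∷-injectiveˡ eq)) (+≤+ le))
  ∷ w-z≥c⇒≥monus[c+z] cs ws ws′ zs (∷-injectiveʳ eq) les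

module _ {d} (V : VASS d) where

  reverse-step-above : ∀ {p q z u w} → (p , z , q) ∈ trans V → w ≥ᵥ map monus (addZ u z) →
    ∃[ u′ ] u′ ≥ᵥ u × ClassicalStep (rev V) (q , w) (p , u′)
  reverse-step-above {z = z} {u} {w} t w≥ with ≥monus[u+z]⇒w-z≥u u w z w≥
  ... | u′ , u′≥u , eq = u′ , u′≥u , step (∈-map⁺ reverseT t) eq

  monus-step-below : ∀ {q w p w′ c} → ClassicalStep (rev V) (q , w) (p , w′) → w′ ≥ᵥ c →
    ∃[ w″ ] w ≥ᵥ w″ × MonusStep V (p , c) (q , w″)
  monus-step-below {w = w} {w′ = w′} {c} (step t eq) w′≥c with ∈-map⁻ reverseT t
  ... | (_ , z , _) , t′ , refl = _ , w-z≥c⇒≥monus[c+z] c w w′ z eq w′≥c , step t′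

  monus-reach⇒reverse-reach : ∀ {p u q w w′} → MonusReach V (p , u) (q , w) → w′ ≥ᵥ w →
    ∃[ u′ ] u′ ≥ᵥ u × ClassicalReach (rev V) (q , w′) (p , u′)
  monus-reach⇒reverse-reach ε w′≥w = _ , w′≥w , ε
  monus-reach⇒reverse-reach (step t ◅ rest) w′≥w
    with monus-reach⇒reverse-reach rest w′≥w
  ... | u₁ , u₁≥ , path with reverse-step-above t u₁≥
  ... | u′ , u′≥u , s = u′ , u′≥u , path ◅◅ s ◅ ε

  reverse-reach⇒monus-reach : ∀ {q w p u′ u} → ClassicalReach (rev V) (q , w) (p , u′) → u′ ≥ᵥ u →
    ∃[ w″ ] w ≥ᵥ w″ × MonusReach V (p , u) (q , w″)
  reverse-reach⇒monus-reach ε u′≥u = _ , u′≥u , ε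
  reverse-reach⇒monus-reach (s ◅ rest) u′≥u
    with reverse-reach⇒monus-reach rest u′≥u
  ... | w₁ , w₁≥ , path with monus-step-below s w₁≥
  ... | w″ , w≥w″ , m = w″ , w≥w″ , path ◅◅ m ◅ ε

0≥ᵥu⇒u≡0 : ∀ {d} {u : Vec ℕ d} → replicate d 0 ≥ᵥ u → u ≡ replicate d 0
0≥ᵥu⇒u≡0 []                 = refl
0≥ᵥu⇒u≡0 (ℕ.z≤n ∷ 0≥ᵥus) = cong (0 ∷_) (0≥ᵥu⇒u≡0 0≥ᵥus)

lemma8 : ∀ {d} (V : VASS d) (s t : Fin (states V)) (v : Vec ℕ d) →
    MonusReach V (s , v) (t , replicate d 0)
      ⇔ Σ (Vec ℕ d) (λ v′ → v′ ≥ᵥ v × ClassicalReach (rev V) (t , replicate d 0) (s , v′))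
lemma8 V s t v = mk⇔
  (λ path → monus-reach⇒reverse-reach V path (Pointwise.refl ℕ.≤-refl))
  λ (_ , v′≥v , path) →
    let _ , 0≥w , monus-path = reverse-reach⇒monus-reach V path v′≥v in
    subst (λ w → MonusReach V (s , v) (t , w)) (0≥ᵥu⇒u≡0 0≥w) monus-path
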